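{- Let $C\ge 1$ be an integer and write $C=\frac{k(k+1)}{2}+r$ with integers $k\ge 1$ and $0\le r\le k$. Then for every $N\ge 2$, $$A(C,N)\ \ge\ \left\lceil \frac{N(N-1)}{2}\cdot\frac{k+1}{k(k+1)+r}\right\rceil .$$
   Context: Fix integers $N\ge 2$ and $C\ge 1$ (the grooming factor). Let $\vec C_N$ be the directed cycle on vertices $0,1,\dots,N-1$ with arcs $(i,i+1 \bmod N)$. For distinct vertices $u,v$ let $d(u,v)=(v-u)\bmod N\in\{1,\dots,N-1\}$ be the length of the directed path from $u$ to $v$ in $\vec C_N$. A request tournament $T_N$ is a tournament on $\{0,\dots,N-1\}$ containing every arc $(u,v)$ with $d(u,v)<N/2$ and, when $N$ is even, exactly one of the two arcs $(i,i+N/2)$, $(i+N/2,i)$ for each $0\le i<N/2$ (this choice being free). Each arc $(u,v)$ of $T_N$ is routed along the directed path from $u$ to $v$ in $\vec C_N$. For a subdigraph $B$ of $T_N$ and an arc $e$ of $\vec C_N$, the load $L(B,e)$ is the number of arcs of $B$ whose route contains $e$; $B$ is admissible if $L(B,e)\le C$ for every arc $e$ of $\vec C_N$. A valid partition is a partition of the arc set of $T_N$ into admissible subdigraphs $B_1,\dots,B_W$, where $V(B_\omega)$ denotes the set of endpoints of arcs of $B_\omega$; its cost is $\sum_{\omega=1}^W |V(B_\omega)|$. $A(C,N)$ denotes the minimum cost of a valid partition, over all choices of the request tournament $T_N$ and all valid partitions of it. -}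

module Defs where

open import Data.Nat using (ℕ; zero; suc; _+_; _*_; _∸_; _≤_; _<_; _≤ᵇ_; _<ᵇ_; _/_)
open import Data.Fin using (Fin; zero; suc; toℕ; _≟_)
open import Data.Bool using (Bool; true; false; if_then_else_; _∧_; _∨_; not)
open import Data.Product using (_×_)
open import Relation.Nullary.Decidable using (⌊_⌋)
open import Relation.Binary.PropositionalEquality using (_≡_; _≢_)

-- d(u,v) = (v - u) mod N, computed without division; off N u u = 0
off : (N : ℕ) → Fin N → Fin N → ℕ
off N u v = if toℕ u ≤ᵇ toℕ v then toℕ v ∸ toℕ u else (N + toℕ v) ∸ toℕ u

countF : (n : ℕ) → (Fin n → Bool) → ℕ
countF zero    f = 0
countF (suc n) f = (if f zero then 1 else 0) + countF n (λ x → f (suc x))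

anyF : (n : ℕ) → (Fin n → Bool) → Bool
anyF zero    f = false
anyF (suc n) f = f zero ∨ anyF n (λ x → f (suc x))

sumF : (n : ℕ) → (Fin n → ℕ) → ℕ
sumF zero    f = 0
sumF (suc n) f = f zero + sumF n (λ x → f (suc x))

-- Request tournament: a tournament (loopless, exactly one arc between distinct vertices)
-- containing every arc (u,v) with d(u,v) < N/2.  (For N even the orientation of the
-- diametral pairs is left free by this definition.)
IsRequestTournament : (N : ℕ) → (Fin N → Fin N → Bool) → Set
IsRequestTournament N T =
  (∀ u → T u u ≡ false) ×
  (∀ u v → u ≢ v → T u v ≡ not (T v u)) ×
  (∀ u v → u ≢ v → 2 * off N u v < N → T u v ≡ true)

-- The route of arc (u,v) contains the cycle arc e_i = (i, i+1 mod N) iff 0 ≤ d(u,i) < d(u,v).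
routeContains : (N : ℕ) → Fin N → Fin N → Fin N → Bool
routeContains N u v i = off N u i <ᵇ off N u v

-- A partition of the arcs of T into B_0,...,B_{W-1} is given by a colouring c:
-- arc (u,v) of T belongs to B_{c u v} (values of c on non-arcs are irrelevant).
inPart : (N W : ℕ) → (Fin N → Fin N → Bool) → (Fin N → Fin N → Fin W) → Fin W → Fin N → Fin N → Bool
inPart N W T c ω u v = T u v ∧ ⌊ c u v ≟ ω ⌋

load : (N W : ℕ) → (Fin N → Fin N → Bool) → (Fin N → Fin N → Fin W) → Fin W → Fin N → ℕ
load N W T c ω i =
  sumF N (λ u → countF N (λ v → inPart N W T c ω u v ∧ routeContains N u v i))

Admissible : (C N W : ℕ) → (Fin N → Fin N → Bool) → (Fin N → Fin N → Fin W) → Set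
Admissible C N W T c = ∀ ω i → load N W T c ω i ≤ C

inVertexSet : (N W : ℕ) → (Fin N → Fin N → Bool) → (Fin N → Fin N → Fin W) → Fin W → Fin N → Bool
inVertexSet N W T c ω x = anyF N (λ y → inPart N W T c ω x y ∨ inPart N W T c ω y x)

cost : (N W : ℕ) → (Fin N → Fin N → Bool) → (Fin N → Fin N → Fin W) → ℕ
cost N W T c = sumF W (λ ω → countF N (inVertexSet N W T c ω))

-- ⌈ a / b ⌉ for b ≥ 1 (value at b = 0 is irrelevant)
ceilDiv : ℕ → ℕ → ℕ
ceilDiv a zero    = 0
ceilDiv a (suc b) = (a + b) / suc b

-- Fix one part B of the partition, with vertex set S. For an arc (u , v) of B let passed(u , v)
-- be the number of x ∈ S whose outgoing cycle arc lies on the route of (u , v). Double counting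
-- gives Σ passed = Σ_{x ∈ S} L(B , e_x) ≤ |S| C. The arcs leaving a fixed u have pairwise
-- distinct values passed ≥ 1 (the route to a farther out-neighbour passes u and every nearer
-- one), so at most J of them have passed ≤ J, and layer-cake counting gives
-- Σ max(0 , k + 1 − passed) ≤ |S| k (k + 1) / 2.
-- Hence |B| (k + 1) ≤ |S| (C + k (k + 1) / 2) = |S| (k (k + 1) + r); summing over the parts,
-- whose arc counts add up to N (N − 1) / 2, gives the bound.

module Submission where

open import Defs
open import Data.Nat using (ℕ; zero; suc; _+_; _*_; _∸_; _≤_; _≥_; _<_; _≤ᵇ_; _<ᵇ_; _≡ᵇ_; z≤n; s≤s; _<?_)
open import Data.Nat.Properties hiding (_≟_)
open import Data.Nat.DivMod using (m<n*o⇒m/o<n)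
open import Data.Nat.Tactic.RingSolver using (solve-∀)
open import Data.Fin using (Fin; zero; suc; toℕ; _≟_)
open import Data.Fin.Properties using (toℕ-injective; toℕ<n; any?)
open import Data.Bool using (Bool; true; false; T; if_then_else_; _∧_)
open import Data.Bool.Properties using (T-∧; T-∨)
open import Data.Unit using (tt)
open import Data.Empty using (⊥; ⊥-elim)
open import Data.Product using (_×_; _,_; proj₁; proj₂)
open import Data.Sum using (_⊎_; inj₁; inj₂)
open import Function using (_∘_; Equivalence)
open import Function.Definitions using (Injective)
open import Relation.Nullary using (¬_; yes; no)
open import Relation.Nullary.Decidable using (⌊_⌋; T?; toWitness; fromWitness)
open import Relation.Binary.PropositionalEquality
open import Algebra.Properties.Semiring.Sum +-*-semiring
  using (sum; sum-cong-≗; sum-replicate-zero; ∑-comm; ∑-distrib-+; *-distribˡ-sum; *-distribʳ-sum)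

sum-mono-≤ : ∀ {n} {f g : Fin n → ℕ} → (∀ x → f x ≤ g x) → sum f ≤ sum g
sum-mono-≤ {zero}  f≤g = z≤n
sum-mono-≤ {suc n} f≤g = +-mono-≤ (f≤g zero) (sum-mono-≤ (f≤g ∘ suc))

sum-const : ∀ n a → sum {n} (λ _ → a) ≡ n * a
sum-const zero    a = refl
sum-const (suc n) a = cong (a +_) (sum-const n a)

∑-comm₃ : ∀ {a b c} (f : Fin a → Fin b → Fin c → ℕ) →
  sum (λ x → sum (λ y → sum (λ z → f x y z))) ≡ sum (λ z → sum (λ x → sum (λ y → f x y z)))
∑-comm₃ {a} {b} {c} f =
  trans (sum-cong-≗ (λ x → ∑-comm (f x))) (∑-comm {a} {c} (λ x z → sum (λ y → f x y z)))

∑∑-distrib-+ : ∀ {a b} (f g : Fin a → Fin b → ℕ) →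
  sum (λ x → sum (λ y → f x y + g x y)) ≡ sum (λ x → sum (f x)) + sum (λ x → sum (g x))
∑∑-distrib-+ {a} f g = trans (sum-cong-≗ (λ x → ∑-distrib-+ (f x) (g x))) (∑-distrib-+ {a} _ _)

𝟙 : Bool → ℕ
𝟙 b = if b then 1 else 0

count : ∀ {n} → (Fin n → Bool) → ℕ
count f = sum (𝟙 ∘ f)

countF≡count : ∀ n (f : Fin n → Bool) → countF n f ≡ count f
countF≡count zero    f = refl
countF≡count (suc n) f = cong (𝟙 (f zero) +_) (countF≡count n (f ∘ suc))

sumF≡sum : ∀ n (f : Fin n → ℕ) → sumF n f ≡ sum f
sumF≡sum zero    f = refl
sumF≡sum (suc n) f = cong (f zero +_) (sumF≡sum n (f ∘ suc))

sumF-countF≡sum-count : ∀ n m (f : Fin n → Fin m → Bool) →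
  sumF n (λ x → countF m (f x)) ≡ sum (λ x → count (f x))
sumF-countF≡sum-count n m f =
  trans (sumF≡sum n _) (sum-cong-≗ (λ x → countF≡count m (f x)))

anyF-intro : ∀ n (f : Fin n → Bool) y → T (f y) → T (anyF n f)
anyF-intro (suc n) f zero    fy = Equivalence.from (T-∨ {f zero}) (inj₁ fy)
anyF-intro (suc n) f (suc y) fy = Equivalence.from (T-∨ {f zero}) (inj₂ (anyF-intro n (f ∘ suc) y fy))

𝟙-∧ : ∀ a b → 𝟙 (a ∧ b) ≡ 𝟙 a * 𝟙 b
𝟙-∧ true  b = sym (+-identityʳ (𝟙 b))
𝟙-∧ false b = refl

𝟙-mono-≤ : ∀ {a b} → (T a → T b) → 𝟙 a ≤ 𝟙 b
𝟙-mono-≤ {false}         _ = z≤n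
𝟙-mono-≤ {true}  {true}  _ = ≤-refl
𝟙-mono-≤ {true}  {false} h = ⊥-elim (h tt)

𝟙-*-monoʳ-≤ : ∀ b {m n} → (T b → m ≤ n) → 𝟙 b * m ≤ 𝟙 b * n
𝟙-*-monoʳ-≤ true  h = *-monoʳ-≤ 1 (h tt)
𝟙-*-monoʳ-≤ false h = z≤n

∧-split : ∀ a {b} → T (a ∧ b) → T a × T b
∧-split _ = Equivalence.to T-∧

∧-pair : ∀ {a b} → T a → T b → T (a ∧ b)
∧-pair ta tb = Equivalence.from T-∧ (ta , tb)

count-mono-≤ : ∀ {n} {f g : Fin n → Bool} → (∀ x → T (f x) → T (g x)) → count f ≤ count g
count-mono-≤ f⇒g = sum-mono-≤ (λ x → 𝟙-mono-≤ (f⇒g x))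

count-none : ∀ {n} {f : Fin n → Bool} → (∀ x → ¬ T (f x)) → count f ≡ 0
count-none {n} ¬f =
  n≤0⇒n≡0 (≤-trans (count-mono-≤ (λ x fx → ¬f x fx)) (≤-reflexive (sum-replicate-zero n)))

count-≟ : ∀ {n} (x : Fin n) → count (λ y → ⌊ x ≟ y ⌋) ≡ 1
count-≟ {suc n} zero    = cong suc (sum-replicate-zero n)
count-≟ {suc n} (suc x) = trans (sum-cong-≗ ⌊suc≟suc⌋) (count-≟ x)
  where
  ⌊suc≟suc⌋ : ∀ y → 𝟙 ⌊ suc x ≟ suc y ⌋ ≡ 𝟙 ⌊ x ≟ y ⌋
  ⌊suc≟suc⌋ y with x ≟ y
  ... | yes _ = refl
  ... | no  _ = refl

count-∪-≤ : ∀ {n} {f g h : Fin n → Bool} → (∀ x → T (f x) → T (g x) ⊎ T (h x)) →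
  count f ≤ count g + count h
count-∪-≤ {g = g} {h} f⇒g∨h =
  ≤-trans (sum-mono-≤ (λ x → 𝟙-∪ (f⇒g∨h x))) (≤-reflexive (∑-distrib-+ (𝟙 ∘ g) (𝟙 ∘ h)))
  where
  𝟙-∪ : ∀ {a b c} → (T a → T b ⊎ T c) → 𝟙 a ≤ 𝟙 b + 𝟙 c
  𝟙-∪ {false}                 _ = z≤n
  𝟙-∪ {true}  {true}          _ = s≤s z≤n
  𝟙-∪ {true}  {false} {true}  _ = ≤-refl
  𝟙-∪ {true}  {false} {false} h with h tt
  ... | inj₁ ()
  ... | inj₂ ()

count-≤1 : ∀ {n} {f : Fin n → Bool} → (∀ x y → T (f x) → T (f y) → x ≡ y) → count f ≤ 1
count-≤1 {f = f} unique with any? (λ x → T? (f x))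
... | yes (x , fx) =
  ≤-trans (count-mono-≤ (λ y fy → fromWitness (unique x y fx fy))) (≤-reflexive (count-≟ x))
... | no ∄x = ≤-trans (≤-reflexive (count-none (λ x fx → ∄x (x , fx)))) z≤n

count-mono-< : ∀ {n} {f g : Fin n → Bool} → (∀ x → T (f x) → T (g x)) →
  (x₀ : Fin n) → T (g x₀) → ¬ T (f x₀) → suc (count f) ≤ count g
count-mono-< {n} {f} {g} f⇒g x₀ gx₀ ¬fx₀ = begin
  suc (count f)                          ≡⟨ +-comm 1 (count f) ⟩
  count f + 1                            ≡⟨ cong (count f +_) (count-≟ x₀) ⟨
  count f + count (λ x → ⌊ x₀ ≟ x ⌋)     ≡⟨ ∑-distrib-+ (𝟙 ∘ f) _ ⟨
  sum (λ x → 𝟙 (f x) + 𝟙 ⌊ x₀ ≟ x ⌋)     ≤⟨ sum-mono-≤ pointwise ⟩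
  count g                                ∎
  where
  open ≤-Reasoning
  𝟙-disjoint-≤ : ∀ {a b c} → (T a → T b → ⊥) → (T a → T c) → (T b → T c) → 𝟙 a + 𝟙 b ≤ 𝟙 c
  𝟙-disjoint-≤ {true}  {true}          disj _  _  = ⊥-elim (disj tt tt)
  𝟙-disjoint-≤ {true}  {false} {true}  _    _  _  = ≤-refl
  𝟙-disjoint-≤ {true}  {false} {false} _    a⇒c _ = ⊥-elim (a⇒c tt)
  𝟙-disjoint-≤ {false} {true}  {true}  _    _  _  = ≤-refl
  𝟙-disjoint-≤ {false} {true}  {false} _    _ b⇒c = ⊥-elim (b⇒c tt)
  𝟙-disjoint-≤ {false} {false}         _    _  _  = z≤n
  pointwise : ∀ x → 𝟙 (f x) + 𝟙 ⌊ x₀ ≟ x ⌋ ≤ 𝟙 (g x)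
  pointwise x = 𝟙-disjoint-≤ (λ fx x₀≡x → ¬fx₀ (subst (T ∘ f) (sym (toWitness x₀≡x)) fx))
                             (f⇒g x) (λ x₀≡x → subst (T ∘ g) (toWitness x₀≡x) gx₀)

module Ranks {n} (p : Fin n → ℕ) (p-injective : Injective _≡_ _≡_ p) (A : Fin n → Bool) where

  below : ℕ → ℕ
  below t = count (λ x → A x ∧ (p x <ᵇ t))

  rank : Fin n → ℕ
  rank v = below (p v)

  below-suc-≤ : ∀ t → below (suc t) ≤ below t + 1
  below-suc-≤ t = ≤-trans (count-∪-≤ split) (+-monoʳ-≤ (below t) (count-≤1 unique))
    where
    split : ∀ x → T (A x ∧ (p x <ᵇ suc t)) → T (A x ∧ (p x <ᵇ t)) ⊎ T (p x ≡ᵇ t)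
    split x h with ∧-split (A x) h
    ... | Ax , px<1+t with m<1+n⇒m<n∨m≡n (<ᵇ⇒< (p x) (suc t) px<1+t)
    ...   | inj₁ px<t = inj₁ (∧-pair Ax (<⇒<ᵇ px<t))
    ...   | inj₂ px≡t = inj₂ (≡⇒≡ᵇ (p x) t px≡t)
    unique : ∀ x y → T (p x ≡ᵇ t) → T (p y ≡ᵇ t) → x ≡ y
    unique x y px≡t py≡t = p-injective (trans (≡ᵇ⇒≡ (p x) t px≡t) (sym (≡ᵇ⇒≡ (p y) t py≡t)))

  -- Induction on the threshold t: the element at position t can only be counted
  -- when fewer than J elements of A precede it.
  count-rank<-before-≤ : ∀ J t → count (λ v → A v ∧ (rank v <ᵇ J) ∧ (p v <ᵇ t)) ≤ J
  count-rank<-before-≤ J zero =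
    subst (_≤ J) (sym (count-none (λ v h → proj₂ (∧-split (rank v <ᵇ J) (proj₂ (∧-split (A v) h)))))) z≤n
  count-rank<-before-≤ J (suc t) with below t <? J
  ... | yes below<J = begin
    count (λ v → A v ∧ (rank v <ᵇ J) ∧ (p v <ᵇ suc t)) ≤⟨ count-mono-≤ drop-rank ⟩
    below (suc t)                                      ≤⟨ below-suc-≤ t ⟩
    below t + 1                                        ≡⟨ +-comm (below t) 1 ⟩
    suc (below t)                                      ≤⟨ below<J ⟩
    J                                                  ∎
    where
    open ≤-Reasoning
    drop-rank : ∀ v → T (A v ∧ (rank v <ᵇ J) ∧ (p v <ᵇ suc t)) → T (A v ∧ (p v <ᵇ suc t))
    drop-rank v h with ∧-split (A v) h
    ... | Av , h′ = ∧-pair Av (proj₂ (∧-split (rank v <ᵇ J) h′))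
  ... | no below≮J = ≤-trans (count-mono-≤ before-t) (count-rank<-before-≤ J t)
    where
    before-t : ∀ v → T (A v ∧ (rank v <ᵇ J) ∧ (p v <ᵇ suc t)) → T (A v ∧ (rank v <ᵇ J) ∧ (p v <ᵇ t))
    before-t v h with ∧-split (A v) h
    ... | Av , h′ with ∧-split (rank v <ᵇ J) h′
    ...   | rank<J , pv<1+t with m<1+n⇒m<n∨m≡n (<ᵇ⇒< (p v) (suc t) pv<1+t)
    ...     | inj₁ pv<t = ∧-pair Av (∧-pair rank<J (<⇒<ᵇ pv<t))
    ...     | inj₂ pv≡t = ⊥-elim (below≮J (subst (λ s → below s < J) pv≡t (<ᵇ⇒< (rank v) J rank<J)))

  count-rank<-≤ : ∀ {t} → (∀ v → p v < t) → ∀ J → count (λ v → A v ∧ (rank v <ᵇ J)) ≤ J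
  count-rank<-≤ {t} p<t J =
    ≤-trans (count-mono-≤ bounded) (count-rank<-before-≤ J t)
    where
    bounded : ∀ v → T (A v ∧ (rank v <ᵇ J)) → T (A v ∧ (rank v <ᵇ J) ∧ (p v <ᵇ t))
    bounded v h with ∧-split (A v) h
    ... | Av , rank<J = ∧-pair Av (∧-pair rank<J (<⇒<ᵇ (p<t v)))

off-cases : ∀ N (u x : Fin N) →
  (toℕ u ≤ toℕ x × off N u x + toℕ u ≡ toℕ x) ⊎ (toℕ x < toℕ u × off N u x + toℕ u ≡ N + toℕ x)
off-cases N u x = cases (toℕ u) (toℕ x) (toℕ<n u)
  where
  cases : ∀ a b → a < N →
    (a ≤ b × (if a ≤ᵇ b then b ∸ a else N + b ∸ a) + a ≡ b) ⊎
    (b < a × (if a ≤ᵇ b then b ∸ a else N + b ∸ a) + a ≡ N + b)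
  cases a b a<N with a ≤ᵇ b in a≤ᵇb
  ... | true  = inj₁ (a≤b , m∸n+n≡m a≤b)
    where a≤b = ≤ᵇ⇒≤ a b (subst T (sym a≤ᵇb) tt)
  ... | false = inj₂ (≰⇒> (λ a≤b → subst T a≤ᵇb (≤⇒≤ᵇ a≤b)) ,
                     m∸n+n≡m (≤-trans (<⇒≤ a<N) (m≤m+n N b)))

off<N : ∀ N (u x : Fin N) → off N u x < N
off<N N u x with off-cases N u x
... | inj₁ (_ , e)   = ≤-<-trans (≤-trans (m≤m+n _ (toℕ u)) (≤-reflexive e)) (toℕ<n x)
... | inj₂ (x<u , e) = +-cancelʳ-< (toℕ u) _ _ (≤-<-trans (≤-reflexive e) (+-monoʳ-< N x<u))

off-self : ∀ N (u : Fin N) → off N u u ≡ 0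
off-self N u with off-cases N u u
... | inj₁ (_ , e)   = +-cancelʳ-≡ (toℕ u) _ 0 e
... | inj₂ (u<u , _) = ⊥-elim (<-irrefl refl u<u)

toℕ≢N+toℕ : ∀ {N} (x y : Fin N) → toℕ x ≢ N + toℕ y
toℕ≢N+toℕ {N} x y eq = <⇒≱ (toℕ<n x) (≤-trans (m≤m+n N (toℕ y)) (≤-reflexive (sym eq)))

off-injective : ∀ N (u : Fin N) → Injective _≡_ _≡_ (off N u)
off-injective N u {x} {y} e with off-cases N u x | off-cases N u y
... | inj₁ (_ , ex) | inj₁ (_ , ey) =
  toℕ-injective (trans (sym ex) (trans (cong (_+ toℕ u) e) ey))
... | inj₂ (_ , ex) | inj₂ (_ , ey) =
  toℕ-injective (+-cancelˡ-≡ N _ _ (trans (sym ex) (trans (cong (_+ toℕ u) e) ey)))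
... | inj₁ (_ , ex) | inj₂ (_ , ey) =
  ⊥-elim (toℕ≢N+toℕ x y (trans (sym ex) (trans (cong (_+ toℕ u) e) ey)))
... | inj₂ (_ , ex) | inj₁ (_ , ey) =
  ⊥-elim (toℕ≢N+toℕ y x (trans (sym ey) (trans (cong (_+ toℕ u) (sym e)) ex)))

-- layers k l = k + 1 ∸ l whenever 1 ≤ l.
layers : ℕ → ℕ → ℕ
layers k l = sum {k} (λ j → 𝟙 (l ≤ᵇ suc (toℕ j)))

suc-≤-+-layers : ∀ k {l} → 1 ≤ l → suc k ≤ l + layers k l
suc-≤-+-layers zero    (s≤s _)          = s≤s z≤n
suc-≤-+-layers (suc k) {suc zero}    _  = s≤s (suc-≤-+-layers k (s≤s z≤n))
suc-≤-+-layers (suc k) {suc (suc l)} _  = s≤s (suc-≤-+-layers k (s≤s z≤n))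

triangular : ∀ k → 2 * sum {k} (λ j → suc (toℕ j)) ≡ k * (k + 1)
triangular zero    = refl
triangular (suc k) = begin
  2 * (1 + sum {k} (λ j → 1 + suc (toℕ j)))
    ≡⟨ cong (λ s → 2 * (1 + s)) (∑-distrib-+ {k} (λ _ → 1) (suc ∘ toℕ)) ⟩
  2 * (1 + (sum {k} (λ _ → 1) + sum {k} (suc ∘ toℕ)))
    ≡⟨ cong (λ s → 2 * (1 + (s + sum {k} (suc ∘ toℕ)))) (sum-const k 1) ⟩
  2 * (1 + (k * 1 + sum {k} (suc ∘ toℕ)))
    ≡⟨ shift k (sum {k} (suc ∘ toℕ)) ⟩
  2 * suc k + 2 * sum {k} (suc ∘ toℕ)
    ≡⟨ cong (2 * suc k +_) (triangular k) ⟩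
  2 * suc k + k * (k + 1)
    ≡⟨ close k ⟩
  suc k * (suc k + 1) ∎
  where
  open ≡-Reasoning
  shift : ∀ k s → 2 * (1 + (k * 1 + s)) ≡ 2 * suc k + 2 * s
  shift = solve-∀
  close : ∀ k → 2 * suc k + k * (k + 1) ≡ suc k * (suc k + 1)
  close = solve-∀

arcCount : ∀ {N} → (Fin N → Fin N → Bool) → ℕ
arcCount P = sum (λ u → count (P u))

module Part (N C : ℕ) (P : Fin N → Fin N → Bool) (S : Fin N → Bool)
  (source∈S : ∀ u v → T (P u v) → T (S u))
  (target∈S : ∀ u v → T (P u v) → T (S v))
  (loopless : ∀ u → ¬ T (P u u))
  (admissible : ∀ x → sum (λ u → count (λ v → P u v ∧ routeContains N u v x)) ≤ C)
  where

  passed : Fin N → Fin N → ℕ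
  passed u v = count (λ x → S x ∧ routeContains N u v x)

  open module OutRanks u = Ranks (off N u) (off-injective N u) (P u) using (rank; count-rank<-≤)

  -- Every earlier out-neighbour of u is passed, and so is u itself.
  suc-rank≤passed : ∀ u v → T (P u v) → suc (rank u v) ≤ passed u v
  suc-rank≤passed u v Puv = count-mono-< earlier⇒passed u (∧-pair (source∈S u v Puv) u-passed)
                                         (λ h → loopless u (proj₁ (∧-split (P u u) h)))
    where
    earlier⇒passed : ∀ w → T (P u w ∧ (off N u w <ᵇ off N u v)) → T (S w ∧ routeContains N u v w)
    earlier⇒passed w h = ∧-pair (target∈S u w (proj₁ (∧-split (P u w) h))) (proj₂ (∧-split (P u w) h))
    v≢u : v ≢ u
    v≢u refl = loopless u Puv
    u-passed : T (routeContains N u v u)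
    u-passed = subst (λ o → T (o <ᵇ off N u v)) (sym (off-self N u))
      (<⇒<ᵇ (n≢0⇒n>0 (λ off≡0 → v≢u (off-injective N u (trans off≡0 (sym (off-self N u)))))))

  count-short-arcs-≤ : ∀ u J → count (λ v → P u v ∧ (passed u v ≤ᵇ J)) ≤ 𝟙 (S u) * J
  count-short-arcs-≤ u J with S u in Su
  ... | true  = ≤-trans (count-mono-≤ short⇒low-rank)
                        (≤-trans (count-rank<-≤ u (off<N N u) J) (≤-reflexive (sym (*-identityˡ J))))
    where
    short⇒low-rank : ∀ v → T (P u v ∧ (passed u v ≤ᵇ J)) → T (P u v ∧ (rank u v <ᵇ J))
    short⇒low-rank v h with ∧-split (P u v) h
    ... | Puv , short = ∧-pair Puv (<⇒<ᵇ (≤-trans (suc-rank≤passed u v Puv) (≤ᵇ⇒≤ _ J short)))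
  ... | false = ≤-reflexive (count-none (λ v h → subst T Su (source∈S u v (proj₁ (∧-split (P u v) h)))))

  partLoad : Fin N → ℕ
  partLoad x = sum (λ u → count (λ v → P u v ∧ routeContains N u v x))

  sum-passed≡sum-partLoad :
    sum (λ u → sum (λ v → 𝟙 (P u v) * passed u v)) ≡ sum (λ x → 𝟙 (S x) * partLoad x)
  sum-passed≡sum-partLoad = begin
    sum (λ u → sum (λ v → 𝟙 (P u v) * passed u v))
      ≡⟨ sum-cong-≗ (λ u → sum-cong-≗ (expand u)) ⟩
    sum (λ u → sum (λ v → sum (λ x → 𝟙 (S x) * 𝟙 (P u v ∧ routeContains N u v x))))
      ≡⟨ ∑-comm₃ {N} {N} {N} _ ⟩
    sum (λ x → sum (λ u → sum (λ v → 𝟙 (S x) * 𝟙 (P u v ∧ routeContains N u v x))))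
      ≡⟨ sum-cong-≗ factor ⟩
    sum (λ x → 𝟙 (S x) * partLoad x) ∎
    where
    open ≡-Reasoning
    swap : ∀ a b c → 𝟙 a * 𝟙 (b ∧ c) ≡ 𝟙 b * 𝟙 (a ∧ c)
    swap a b c = begin
      𝟙 a * 𝟙 (b ∧ c)     ≡⟨ cong (𝟙 a *_) (𝟙-∧ b c) ⟩
      𝟙 a * (𝟙 b * 𝟙 c)   ≡⟨ left-comm (𝟙 a) (𝟙 b) (𝟙 c) ⟩
      𝟙 b * (𝟙 a * 𝟙 c)   ≡⟨ cong (𝟙 b *_) (𝟙-∧ a c) ⟨
      𝟙 b * 𝟙 (a ∧ c)     ∎
      where
      left-comm : ∀ x y z → x * (y * z) ≡ y * (x * z)
      left-comm = solve-∀
    expand : ∀ u v →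
      𝟙 (P u v) * passed u v ≡ sum (λ x → 𝟙 (S x) * 𝟙 (P u v ∧ routeContains N u v x))
    expand u v = trans (*-distribˡ-sum {N} (𝟙 (P u v)) _) (sum-cong-≗ (λ x → swap (P u v) (S x) _))
    factor : ∀ x →
      sum (λ u → sum (λ v → 𝟙 (S x) * 𝟙 (P u v ∧ routeContains N u v x))) ≡ 𝟙 (S x) * partLoad x
    factor x = sym (trans (*-distribˡ-sum {N} (𝟙 (S x)) _)
                          (sum-cong-≗ {N} (λ u → *-distribˡ-sum {N} (𝟙 (S x)) _)))

  sum-passed-≤ : sum (λ u → sum (λ v → 𝟙 (P u v) * passed u v)) ≤ count S * C
  sum-passed-≤ = begin
    sum (λ u → sum (λ v → 𝟙 (P u v) * passed u v))  ≡⟨ sum-passed≡sum-partLoad ⟩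
    sum (λ x → 𝟙 (S x) * partLoad x)                ≤⟨ sum-mono-≤ (λ x → *-monoʳ-≤ (𝟙 (S x)) (admissible x)) ⟩
    sum (λ x → 𝟙 (S x) * C)                         ≡⟨ *-distribʳ-sum C (𝟙 ∘ S) ⟨
    count S * C                                     ∎
    where open ≤-Reasoning

  sum-layers-≤ : ∀ k →
    sum (λ u → sum (λ v → 𝟙 (P u v) * layers k (passed u v))) ≤ count S * sum {k} (suc ∘ toℕ)
  sum-layers-≤ k = begin
    sum (λ u → sum (λ v → 𝟙 (P u v) * layers k (passed u v)))
      ≡⟨ sum-cong-≗ (λ u → sum-cong-≗ (expand u)) ⟩
    sum (λ u → sum (λ v → sum {k} (λ j → 𝟙 (P u v ∧ (passed u v ≤ᵇ suc (toℕ j))))))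
      ≡⟨ ∑-comm₃ {N} {N} {k} _ ⟩
    sum {k} (λ j → sum (λ u → count (λ v → P u v ∧ (passed u v ≤ᵇ suc (toℕ j)))))
      ≤⟨ sum-mono-≤ {k} (λ j → sum-mono-≤ (λ u → count-short-arcs-≤ u (suc (toℕ j)))) ⟩
    sum {k} (λ j → sum (λ u → 𝟙 (S u) * suc (toℕ j)))
      ≡⟨ sum-cong-≗ {k} (λ j → *-distribʳ-sum (suc (toℕ j)) (𝟙 ∘ S)) ⟨
    sum {k} (λ j → count S * suc (toℕ j))
      ≡⟨ *-distribˡ-sum {k} (count S) (suc ∘ toℕ) ⟨
    count S * sum {k} (suc ∘ toℕ) ∎
    where
    open ≤-Reasoning
    expand : ∀ u v →
      𝟙 (P u v) * layers k (passed u v) ≡ sum {k} (λ j → 𝟙 (P u v ∧ (passed u v ≤ᵇ suc (toℕ j))))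
    expand u v = trans (*-distribˡ-sum {k} (𝟙 (P u v)) _)
                       (sum-cong-≗ {k} (λ j → sym (𝟙-∧ (P u v) (passed u v ≤ᵇ suc (toℕ j)))))

  arcCount-*-suc-≤ : ∀ k → arcCount P * suc k ≤ count S * C + count S * sum {k} (suc ∘ toℕ)
  arcCount-*-suc-≤ k = begin
    arcCount P * suc k
      ≡⟨ trans (*-distribʳ-sum {N} (suc k) _) (sum-cong-≗ (λ u → *-distribʳ-sum (suc k) (𝟙 ∘ P u))) ⟩
    sum (λ u → sum (λ v → 𝟙 (P u v) * suc k))
      ≤⟨ sum-mono-≤ (λ u → sum-mono-≤ (λ v → covered u v)) ⟩
    sum (λ u → sum (λ v → 𝟙 (P u v) * passed u v + 𝟙 (P u v) * layers k (passed u v)))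
      ≡⟨ ∑∑-distrib-+ (λ u v → 𝟙 (P u v) * passed u v) (λ u v → 𝟙 (P u v) * layers k (passed u v)) ⟩
    sum (λ u → sum (λ v → 𝟙 (P u v) * passed u v)) +
    sum (λ u → sum (λ v → 𝟙 (P u v) * layers k (passed u v)))
      ≤⟨ +-mono-≤ sum-passed-≤ (sum-layers-≤ k) ⟩
    count S * C + count S * sum {k} (suc ∘ toℕ) ∎
    where
    open ≤-Reasoning
    covered : ∀ u v → 𝟙 (P u v) * suc k ≤ 𝟙 (P u v) * passed u v + 𝟙 (P u v) * layers k (passed u v)
    covered u v = ≤-trans
      (𝟙-*-monoʳ-≤ (P u v) (λ Puv → suc-≤-+-layers k (≤-trans (s≤s z≤n) (suc-rank≤passed u v Puv))))
      (≤-reflexive (*-distribˡ-+ (𝟙 (P u v)) (passed u v) _))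

  arcCount-bound : ∀ k → 2 * (arcCount P * suc k) ≤ count S * (2 * C + k * (k + 1))
  arcCount-bound k = begin
    2 * (arcCount P * suc k)                                ≤⟨ *-monoʳ-≤ 2 (arcCount-*-suc-≤ k) ⟩
    2 * (count S * C + count S * sum {k} (suc ∘ toℕ))       ≡⟨ distribute (count S) C _ ⟩
    count S * (2 * C + 2 * sum {k} (suc ∘ toℕ))             ≡⟨ cong (λ t → count S * (2 * C + t)) (triangular k) ⟩
    count S * (2 * C + k * (k + 1))                         ∎
    where
    open ≤-Reasoning
    distribute : ∀ s c t → 2 * (s * c + s * t) ≡ s * (2 * c + 2 * t)
    distribute = solve-∀

arcCount-partition : ∀ {N W} (R : Fin N → Fin N → Bool) (c : Fin N → Fin N → Fin W) →
  sum (λ ω → arcCount (inPart N W R c ω)) ≡ arcCount R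
arcCount-partition {N} {W} R c = begin
  sum (λ ω → sum (λ u → sum (λ v → 𝟙 (R u v ∧ ⌊ c u v ≟ ω ⌋))))  ≡⟨ ∑-comm₃ {N} {N} {W} _ ⟨
  sum (λ u → sum (λ v → sum (λ ω → 𝟙 (R u v ∧ ⌊ c u v ≟ ω ⌋))))  ≡⟨ sum-cong-≗ (λ u → sum-cong-≗ (λ v → one-part u v)) ⟩
  arcCount R                                                     ∎
  where
  open ≡-Reasoning
  one-part : ∀ u v → sum (λ ω → 𝟙 (R u v ∧ ⌊ c u v ≟ ω ⌋)) ≡ 𝟙 (R u v)
  one-part u v = begin
    sum (λ ω → 𝟙 (R u v ∧ ⌊ c u v ≟ ω ⌋))    ≡⟨ sum-cong-≗ (λ ω → 𝟙-∧ (R u v) ⌊ c u v ≟ ω ⌋) ⟩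
    sum (λ ω → 𝟙 (R u v) * 𝟙 ⌊ c u v ≟ ω ⌋)  ≡⟨ *-distribˡ-sum {W} (𝟙 (R u v)) _ ⟨
    𝟙 (R u v) * count (λ ω → ⌊ c u v ≟ ω ⌋)  ≡⟨ cong (𝟙 (R u v) *_) (count-≟ (c u v)) ⟩
    𝟙 (R u v) * 1                            ≡⟨ *-identityʳ _ ⟩
    𝟙 (R u v)                                ∎

arcCount-tournament : ∀ {N} (R : Fin N → Fin N → Bool) → IsRequestTournament N R →
  2 * arcCount R ≡ N * (N ∸ 1)
arcCount-tournament {N} R (loopless , antisymmetric , _) = begin
  2 * arcCount R                           ≡⟨ cong (arcCount R +_) (+-identityʳ _) ⟩
  arcCount R + arcCount R                  ≡⟨ m+n∸n≡m _ N ⟨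
  arcCount R + arcCount R + N ∸ N          ≡⟨ cong (_∸ N) all-pairs ⟩
  N * N ∸ N                                ≡⟨ cong (N * N ∸_) (*-identityʳ N) ⟨
  N * N ∸ N * 1                            ≡⟨ *-distribˡ-∸ N N 1 ⟨
  N * (N ∸ 1)                              ∎
  where
  open ≡-Reasoning
  one-of-three : ∀ u v → 𝟙 (R u v) + 𝟙 (R v u) + 𝟙 ⌊ u ≟ v ⌋ ≡ 1
  one-of-three u v with u ≟ v
  ... | yes refl rewrite loopless u = refl
  ... | no u≢v rewrite antisymmetric u v u≢v with R v u
  ...   | true  = refl
  ...   | false = refl
  D = sum {N} (λ u → count (λ v → ⌊ u ≟ v ⌋))
  ones : sum {N} (λ _ → 1) ≡ N
  ones = trans (sum-const N 1) (*-identityʳ N)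
  all-pairs : arcCount R + arcCount R + N ≡ N * N
  all-pairs = begin
    arcCount R + arcCount R + N
      ≡⟨ cong₂ (λ a b → arcCount R + a + b) (∑-comm (λ u v → 𝟙 (R u v)))
               (trans (sym ones) (sum-cong-≗ {N} (λ u → sym (count-≟ u)))) ⟩
    arcCount R + sum (λ u → sum (λ v → 𝟙 (R v u))) + D
      ≡⟨ cong (_+ D) (∑∑-distrib-+ (λ u v → 𝟙 (R u v)) (λ u v → 𝟙 (R v u))) ⟨
    sum (λ u → sum (λ v → 𝟙 (R u v) + 𝟙 (R v u))) + D
      ≡⟨ ∑∑-distrib-+ (λ u v → 𝟙 (R u v) + 𝟙 (R v u)) (λ (u v : Fin N) → 𝟙 ⌊ u ≟ v ⌋) ⟨
    sum (λ u → sum (λ v → 𝟙 (R u v) + 𝟙 (R v u) + 𝟙 ⌊ u ≟ v ⌋))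
      ≡⟨ sum-cong-≗ (λ u → trans (sum-cong-≗ (one-of-three u)) ones) ⟩
    sum {N} (λ _ → N)
      ≡⟨ sum-const N N ⟩
    N * N ∎

cost-bound : ∀ {C N W} k (R : Fin N → Fin N → Bool) → (∀ u → R u u ≡ false) →
  (c : Fin N → Fin N → Fin W) → Admissible C N W R c →
  2 * (arcCount R * suc k) ≤ cost N W R c * (2 * C + k * (k + 1))
cost-bound {C} {N} {W} k R loopless c admissible = begin
  2 * (arcCount R * suc k)                   ≡⟨ cong (λ e → 2 * (e * suc k)) (arcCount-partition R c) ⟨
  2 * (sum (λ ω → arcCount (P ω)) * suc k)   ≡⟨ trans (cong (2 *_) (*-distribʳ-sum {W} (suc k) _)) (*-distribˡ-sum {W} 2 _) ⟩
  sum (λ ω → 2 * (arcCount (P ω) * suc k))   ≤⟨ sum-mono-≤ part-bound ⟩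
  sum (λ ω → count (S ω) * Q)                ≡⟨ *-distribʳ-sum {W} Q _ ⟨
  sum (λ ω → count (S ω)) * Q                ≡⟨ cong (_* Q) (sumF-countF≡sum-count W N S) ⟨
  cost N W R c * Q                           ∎
  where
  open ≤-Reasoning
  Q = 2 * C + k * (k + 1)
  P = inPart N W R c
  S = inVertexSet N W R c
  part-bound : ∀ ω → 2 * (arcCount (P ω) * suc k) ≤ count (S ω) * Q
  part-bound ω = Part.arcCount-bound N C (P ω) (S ω)
    (λ u v Puv → anyF-intro N _ v (Equivalence.from (T-∨ {P ω u v}) (inj₁ Puv)))
    (λ u v Puv → anyF-intro N _ u (Equivalence.from (T-∨ {P ω v u}) (inj₂ Puv)))
    (λ u Puu → subst T (loopless u) (proj₁ (∧-split (R u u) Puu)))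
    (λ x → subst (_≤ C) (sumF-countF≡sum-count N N _) (admissible ω x))
    k

ceilDiv-≤ : ∀ a q c → a ≤ c * q → ceilDiv a q ≤ c
ceilDiv-≤ a zero    c _    = z≤n
ceilDiv-≤ a (suc q) c a≤cq =
  ≤-pred (m<n*o⇒m/o<n (subst (a + q <_) (+-comm (c * suc q) (suc q)) (+-mono-≤-< a≤cq (n<1+n q))))

-- The side conditions C ≥ 1, k ≥ 1, r ≤ k and N ≥ 2 only make k and r unique; the bound
-- holds for every decomposition 2C = k(k+1) + 2r.
theorem1 : (C k r : ℕ) → C ≥ 1 → k ≥ 1 → r ≤ k → 2 * C ≡ k * (k + 1) + 2 * r →
    (N : ℕ) → N ≥ 2 →
    (T : Fin N → Fin N → Bool) → IsRequestTournament N T →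
    (W : ℕ) → (c : Fin N → Fin N → Fin W) → Admissible C N W T c →
    cost N W T c ≥ ceilDiv (N * (N ∸ 1) * (k + 1)) (2 * (k * (k + 1) + r))
theorem1 C k r _ _ _ 2C≡ N _ R isR W c admissible = ceilDiv-≤ _ _ _ (begin
  N * (N ∸ 1) * (k + 1)                   ≡⟨ cong (_* (k + 1)) (arcCount-tournament R isR) ⟨
  2 * arcCount R * (k + 1)                ≡⟨ reassoc (arcCount R) k ⟩
  2 * (arcCount R * suc k)                ≤⟨ cost-bound k R (proj₁ isR) c admissible ⟩
  cost N W R c * (2 * C + k * (k + 1))    ≡⟨ cong (cost N W R c *_) denominator ⟩
  cost N W R c * (2 * (k * (k + 1) + r))  ∎)
  where
  open ≤-Reasoning
  reassoc : ∀ e k → 2 * e * (k + 1) ≡ 2 * (e * suc k)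
  reassoc = solve-∀
  regroup : ∀ t r → t + 2 * r + t ≡ 2 * (t + r)
  regroup = solve-∀
  denominator : 2 * C + k * (k + 1) ≡ 2 * (k * (k + 1) + r)
  denominator = trans (cong (_+ k * (k + 1)) 2C≡) (regroup (k * (k + 1)) r)
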